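{- Let $\mathscr{M}$ be a minion, $\mathcal{D}$ a description over $\mathscr{M}$, $Q$ a $\mathcal{D}$-stable property over $\mathscr{M}$, and $h\in\mathbb{N}$. Suppose that for each $f\in Q$ there is an internal reference $\phi_f(x)$ to $Q$ w.r.t. $\mathcal{D}$ of arity at most $h$ such that $\mathscr{M}\models\phi_f(f)$. Then $Q$ is internal at arity $h$ w.r.t. $\mathcal{D}$.
   Context: Minions: disjoint sets $\mathscr{M}(n)$, $n\in\mathbb{N}$, with maps $f\mapsto f^\pi\in\mathscr{M}(m)$ for $\pi:[n]\to[m]$, satisfying $f^{\mathrm{id}}=f$ and $f^{\pi_1\circ\pi_2}=(f^{\pi_2})^{\pi_1}$. A partial homomorphism up to arity $h$, $F:\mathscr{M}\rightharpoonup_h\mathscr{N}$, is an arity-preserving map defined exactly on the elements of arity at most $h$ with $F(f^\pi)=F(f)^\pi$ whenever both sides are defined. pp-formulas: terms are built from variables, each with an arity, via $t\mapsto t^\pi$ ($\pi:[n]\to[m]$ turns an $n$-ary term into an $m$-ary term); atomic formulas are equalities between terms of the same arity; pp-formulas are built from atomic formulas using $\wedge$ and $\exists$; the arity of a formula is the maximum arity of its subterms. Satisfaction $\mathscr{M}\models\phi(f_1,\dots,f_k)$ is the usual one. Descriptions: an $n$-ary property is a subset $P\subseteq\mathscr{M}(n)$; a description is a set $\mathcal{D}$ of properties. For $f,g\in\mathscr{M}(n)$, $f\sim_\mathcal{D}g$ iff for every $P\in\mathcal{D}$ and $\pi:[n]\to[\mathrm{ar}(P)]$, $f^\pi\in P\iff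 g^\pi\in P$. $\mathscr{M}/\mathcal{D}$ is the quotient minion with classes $[f]$ and $[f]^\pi=[f^\pi]$; for a property $Q$, $Q/\mathcal{D}=\{[f]:f\in Q\}$. $Q$ is $\mathcal{D}$-stable if $f\sim_\mathcal{D}g$ and $f\in Q$ imply $g\in Q$. For $h\ge\mathrm{ar}(Q)$, $Q$ is internal at arity $h$ w.r.t. $\mathcal{D}$ if it is $\mathcal{D}$-stable and every partial homomorphism $F:\mathscr{M}\rightharpoonup_h\mathscr{M}/\mathcal{D}$ satisfies $F(Q)\subseteq Q/\mathcal{D}$. An internal reference to $Q$ w.r.t. $\mathcal{D}$ is a pp-formula $\Phi(x)$ with one free variable $x$ of arity $\mathrm{ar}(Q)$ such that $\mathscr{M}/\mathcal{D}\models\Phi([f])$ implies $[f]\in Q/\mathcal{D}$. -}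

module Defs where

open import Level using (Level; _⊔_; suc)
open import Data.Nat using (ℕ; _≤_) renaming (_⊔_ to _⊔ₙ_)
open import Data.Fin using (Fin)
open import Data.List using (List; []; _∷_)
open import Data.List.Membership.Propositional using (_∈_)
open import Data.List.Relation.Unary.All using (All; lookup) renaming ([] to []ᵃ; _∷_ to _∷ᵃ_)
open import Data.Product using (Σ; _×_; ∃)
open import Function using (id; _∘_; _⇔_)
open import Relation.Binary.PropositionalEquality using (_≡_)

-- Minions.  M n is the set of n-ary elements (disjointness is automatic
-- since the family is indexed by n);  act π f  is  f^π  for π : [n] → [m].

record Minion (a : Level) : Set (suc a) where
  field
    M      : ℕ → Set a
    act    : ∀ {n m} → (Fin n → Fin m) → M n → M m
    act-id : ∀ {n} (f : M n) → act id f ≡ f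
    act-∘  : ∀ {n k m} (π₁ : Fin k → Fin m) (π₂ : Fin n → Fin k) (f : M n) →
             act (π₁ ∘ π₂) f ≡ act π₁ (act π₂ f)
    -- maps [n] → [m] are set-theoretic functions, hence extensional
    act-cong : ∀ {n m} {π π′ : Fin n → Fin m} → (∀ i → π i ≡ π′ i) →
               (f : M n) → act π f ≡ act π′ f

-- pp-formulas.  Contexts are lists of variable arities (de Bruijn style).

Ctx : Set
Ctx = List ℕ

data Term (Γ : Ctx) : ℕ → Set where
  var : ∀ {n} → n ∈ Γ → Term Γ n
  _^_ : ∀ {n m} → Term Γ n → (Fin n → Fin m) → Term Γ m

data Formula (Γ : Ctx) : Set where
  _≐_  : ∀ {n} → Term Γ n → Term Γ n → Formula Γ
  _∧_  : Formula Γ → Formula Γ → Formula Γ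
  ∃′   : (n : ℕ) → Formula (n ∷ Γ) → Formula Γ

termArity : ∀ {Γ n} → Term Γ n → ℕ
termArity {n = n} (var x) = n
termArity {n = m} (t ^ π) = m ⊔ₙ termArity t

arity : ∀ {Γ} → Formula Γ → ℕ
arity (t ≐ s)  = termArity t ⊔ₙ termArity s
arity (φ ∧ ψ)  = arity φ ⊔ₙ arity ψ
arity (∃′ n φ) = arity φ

-- Satisfaction in a "setoid minion": a family A, an action, and an
-- equality relation per arity (≡ for M itself, ∼_D for M/D).
module Sat {a e : Level} (A : ℕ → Set a)
           (act : ∀ {n m} → (Fin n → Fin m) → A n → A m)
           (_≈_ : ∀ {n} → A n → A n → Set e) where

  Env : Ctx → Set a
  Env Γ = All A Γ

  ⟦_⟧ : ∀ {Γ n} → Term Γ n → Env Γ → A n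
  ⟦ var x ⟧ ρ = lookup ρ x
  ⟦ t ^ π ⟧ ρ = act π (⟦ t ⟧ ρ)

  _⊨_ : ∀ {Γ} → Env Γ → Formula Γ → Set (a ⊔ e)
  ρ ⊨ (t ≐ s)  = Lift′ (⟦ t ⟧ ρ ≈ ⟦ s ⟧ ρ)
    where Lift′ : Set e → Set (a ⊔ e)
          Lift′ X = Level.Lift a X
  ρ ⊨ (φ ∧ ψ)  = (ρ ⊨ φ) × (ρ ⊨ ψ)
  ρ ⊨ (∃′ n φ) = Σ (A n) (λ f → (f ∷ᵃ ρ) ⊨ φ)

module _ {a : Level} (𝓜 : Minion a) where
  open Minion 𝓜

  record Property (p : Level) : Set (a ⊔ suc p) where
    field
      ar   : ℕ
      pred : M ar → Set p
  open Property public

  record Description (i p : Level) : Set (a ⊔ suc i ⊔ suc p) where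
    field
      Idx  : Set i
      prop : Idx → Property p
  open Description public

  module _ {i p : Level} (𝓓 : Description i p) where

    _∼_ : ∀ {n} → M n → M n → Set (i ⊔ p)
    _∼_ {n} f g = (d : Idx 𝓓) (π : Fin n → Fin (ar (prop 𝓓 d))) →
                  pred (prop 𝓓 d) (act π f) ⇔ pred (prop 𝓓 d) (act π g)

    -- M ⊨ φ(ρ)   and   M/D ⊨ φ([ρ])  (classes represented by elements,
    -- with [f]^π = [f^π] and equality of classes = ∼_D)
    module SatM  = Sat {e = a} M act _≡_
    module SatMD = Sat {e = i ⊔ p} M act _∼_

    InQuot : ∀ {q} (Q : Property q) → M (ar Q) → Set _
    InQuot Q f = ∃ λ g → pred Q g × (g ∼ f)

    Stable : ∀ {q} → Property q → Set _
    Stable Q = ∀ {f g} → f ∼ g → pred Q f → pred Q g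

    -- partial homomorphisms M ⇀_h M/D (classes given by representatives)
    record PartialHom (h : ℕ) : Set (a ⊔ i ⊔ p) where
      field
        F   : ∀ {n} → n ≤ h → M n → M n
        hom : ∀ {n m} (p : n ≤ h) (q : m ≤ h) (π : Fin n → Fin m) (f : M n) →
              F q (act π f) ∼ act π (F p f)
    open PartialHom public

    -- Q internal at arity h w.r.t. D  (meaningful for h ≥ ar Q)
    InternalAt : ∀ {q} → ℕ → Property q → Set _
    InternalAt h Q = Stable Q ×
      ((Φ : PartialHom h) (le : ar Q ≤ h) (f : M (ar Q)) → pred Q f →
        InQuot Q (F Φ le f))

    InternalRef : ∀ {q} (Q : Property q) → Formula (ar Q ∷ []) → Set _
    InternalRef Q Φ = (f : M (ar Q)) → SatMD._⊨_ (f ∷ᵃ []ᵃ) Φ → InQuot Q f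

-- A partial homomorphism F up to arity h, extended by the identity above h,
-- sends every satisfying assignment of a pp-formula of arity ≤ h in M to a
-- satisfying assignment in M/D: terms are evaluated only at arities ≤ h, where
-- F commutes with minor operations up to ∼_D.  So if f ∈ Q and M ⊨ φ_f(f), then
-- M/D ⊨ φ_f(F f), and φ_f being an internal reference gives F f ∈ Q/D.
module Submission where

open import Defs
open import Level using (Level; lift)
open import Data.Nat using (ℕ; _≤_; _≤?_)
open import Data.Nat.Properties using (≤-irrelevant; ≤-refl; ≤-trans; m≤m⊔n; m⊔n≤o⇒m≤o; m⊔n≤o⇒n≤o)
open import Data.Fin using (Fin)
open import Data.Product using (Σ; _×_; _,_)
open import Data.List using ([]; _∷_)
open import Data.List.Relation.Unary.All as All using (All) renaming ([] to []ᵃ; _∷_ to _∷ᵃ_)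
open import Data.List.Relation.Unary.All.Properties using (lookup-map)
open import Function using (_∘_)
open import Function.Properties.Equivalence using (⇔-isEquivalence)
open import Relation.Binary.Structures using (IsEquivalence)
open import Relation.Binary.PropositionalEquality using (_≡_; refl; sym; cong; subst)
open import Relation.Nullary using (yes; no; contradiction)

private
  module ⇔ {ℓ} = IsEquivalence (⇔-isEquivalence {ℓ})

module Congruence {a i p : Level} (𝓜 : Minion a) (𝓓 : Description 𝓜 i p) where
  open Minion 𝓜

  private
    _≈_ : ∀ {n} → M n → M n → Set (i Level.⊔ p)
    _≈_ = _∼_ 𝓜 𝓓

  ∼-refl : ∀ {n} {f : M n} → f ≈ f
  ∼-refl d π = ⇔.refl

  ∼-sym : ∀ {n} {f g : M n} → f ≈ g → g ≈ f
  ∼-sym f∼g d π = ⇔.sym (f∼g d π)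

  ∼-trans : ∀ {n} {f g k : M n} → f ≈ g → g ≈ k → f ≈ k
  ∼-trans f∼g g∼k d π = ⇔.trans (f∼g d π) (g∼k d π)

  ∼-reflexive : ∀ {n} {f g : M n} → f ≡ g → f ≈ g
  ∼-reflexive refl = ∼-refl

  act-resp-∼ : ∀ {n m} (π : Fin n → Fin m) {f g : M n} → f ≈ g → act π f ≈ act π g
  act-resp-∼ π {f} {g} f∼g d σ =
    ⇔.trans (⇔.reflexive (cong P (sym (act-∘ σ π f))))
      (⇔.trans (f∼g d (σ ∘ π)) (⇔.reflexive (cong P (act-∘ σ π g))))
    where P = pred (prop 𝓓 d)

termArity-≥ : ∀ {Γ n} (t : Term Γ n) → n ≤ termArity t
termArity-≥ (var x) = ≤-refl
termArity-≥ (t ^ π) = m≤m⊔n _ _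

module Preservation {a i p : Level} (𝓜 : Minion a) (𝓓 : Description 𝓜 i p)
                    {h : ℕ} (Φ : PartialHom 𝓜 𝓓 h) where
  open Minion 𝓜
  open Congruence 𝓜 𝓓
  module SM = SatM 𝓜 𝓓
  module SD = SatMD 𝓜 𝓓

  private
    _≈_ : ∀ {n} → M n → M n → Set (i Level.⊔ p)
    _≈_ = _∼_ 𝓜 𝓓

  -- Bound variables of arity > h never occur in a term of a formula of arity ≤ h,
  -- so any value may be used for them.
  totalF : ∀ {n} → M n → M n
  totalF {n} f with n ≤? h
  ... | yes n≤h = F Φ n≤h f
  ... | no _    = f

  totalF-extends : ∀ {n} (n≤h : n ≤ h) (f : M n) → totalF f ≡ F Φ n≤h f
  totalF-extends {n} n≤h f with n ≤? h
  ... | yes n≤h′ = cong (λ le → F Φ le f) (≤-irrelevant n≤h′ n≤h)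
  ... | no  n≰h  = contradiction n≤h n≰h

  totalF-hom : ∀ {n m} → n ≤ h → m ≤ h → (π : Fin n → Fin m) (f : M n) →
               totalF (act π f) ≈ act π (totalF f)
  totalF-hom n≤h m≤h π f
    rewrite totalF-extends m≤h (act π f) | totalF-extends n≤h f = hom Φ n≤h m≤h π f

  ⟦⟧-totalF : ∀ {Γ n} (ρ : All M Γ) (t : Term Γ n) → termArity t ≤ h →
              SD.⟦ t ⟧ (All.map totalF ρ) ≈ totalF (SM.⟦ t ⟧ ρ)
  ⟦⟧-totalF ρ (var x) _ = ∼-reflexive (lookup-map ρ x)
  ⟦⟧-totalF ρ (t ^ π) ar≤h =
    ∼-trans (act-resp-∼ π (⟦⟧-totalF ρ t t≤h))
            (∼-sym (totalF-hom (≤-trans (termArity-≥ t) t≤h) (m⊔n≤o⇒m≤o _ _ ar≤h) π (SM.⟦ t ⟧ ρ)))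
    where t≤h = m⊔n≤o⇒n≤o _ _ ar≤h

  ⊨-totalF : ∀ {Γ} (ρ : All M Γ) (φ : Formula Γ) → arity φ ≤ h →
             SM._⊨_ ρ φ → SD._⊨_ (All.map totalF ρ) φ
  ⊨-totalF ρ (t ≐ s) ar≤h (lift ⟦t⟧≡⟦s⟧) =
    lift (∼-trans (⟦⟧-totalF ρ t (m⊔n≤o⇒m≤o _ _ ar≤h))
           (∼-trans (∼-reflexive (cong totalF ⟦t⟧≡⟦s⟧))
                    (∼-sym (⟦⟧-totalF ρ s (m⊔n≤o⇒n≤o _ _ ar≤h)))))
  ⊨-totalF ρ (φ ∧ ψ) ar≤h (⊨φ , ⊨ψ) =
    ⊨-totalF ρ φ (m⊔n≤o⇒m≤o _ _ ar≤h) ⊨φ , ⊨-totalF ρ ψ (m⊔n≤o⇒n≤o _ _ ar≤h) ⊨ψ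
  ⊨-totalF ρ (∃′ n φ) ar≤h (f , ⊨φ) = totalF f , ⊨-totalF (f ∷ᵃ ρ) φ ar≤h ⊨φ

  F-preserves-⊨ : ∀ {n} (n≤h : n ≤ h) (φ : Formula (n ∷ [])) → arity φ ≤ h →
                  (f : M n) → SM._⊨_ (f ∷ᵃ []ᵃ) φ → SD._⊨_ (F Φ n≤h f ∷ᵃ []ᵃ) φ
  F-preserves-⊨ n≤h φ ar≤h f ⊨φ =
    subst (λ g → SD._⊨_ (g ∷ᵃ []ᵃ) φ) (totalF-extends n≤h f) (⊨-totalF (f ∷ᵃ []ᵃ) φ ar≤h ⊨φ)

lemma5p1 : {a i p q : Level} (𝓜 : Minion a) (𝓓 : Description 𝓜 i p)
    (Q : Property 𝓜 q) (h : ℕ) → ar Q ≤ h → Stable 𝓜 𝓓 Q →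
    ((f : Minion.M 𝓜 (ar Q)) → pred Q f →
    Σ (Formula (ar Q ∷ [])) (λ φ →
    InternalRef 𝓜 𝓓 Q φ × arity φ ≤ h × SatM._⊨_ 𝓜 𝓓 (f ∷ᵃ []ᵃ) φ)) →
    InternalAt 𝓜 𝓓 h Q
lemma5p1 𝓜 𝓓 Q h _ stable references = stable , F-internal
  where
  F-internal : (Φ : PartialHom 𝓜 𝓓 h) (arQ≤h : ar Q ≤ h) (f : Minion.M 𝓜 (ar Q)) →
               pred Q f → InQuot 𝓜 𝓓 Q (F Φ arQ≤h f)
  F-internal Φ arQ≤h f f∈Q with references f f∈Q
  ... | φ , isReference , φ≤h , ⊨φ =
    isReference (F Φ arQ≤h f) (Preservation.F-preserves-⊨ 𝓜 𝓓 Φ arQ≤h φ φ≤h f ⊨φ)
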